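{- Let $k\ge 3$, $b_k=2(k-2)$, and let $\overline{c}=(c_1,\dots,c_{b_k})$ be a balanced 2-flat sequence of integers from $[0,2^{k-1}-1]$, with $s=height(\overline{c})$ and $\overline{d}=reduce(\overline{c})$. Then $(\bigotimes\hat{Q}^k_1)(\overline{d})\in I(X^k_1)$, where $I(X^k_1)=I(k-1)\times J_2\times\dots\times J_{k-2}$ with $J_l=I(-k)$ if $l\equiv 0\pmod 3$ and $J_l=I(\pm k)$ otherwise.
   Context: A sequence $(c_1,\dots,c_{2m})$ is flat if $c_1\le c_2\le\dots\le c_{2m}\le c_1+1$; 2-flat if $(c_1,c_3,\dots,c_{2m-1})$ and $(c_2,c_4,\dots,c_{2m})$ are flat; balanced if $c_i+c_{2m-i+1}=c_1+c_{2m}$ for $i=2,\dots,m$, and then $height(\overline{c})=c_1+c_{2m}$. For balanced $\overline{c}\in\mathbb{R}^{b_k}$ of height $s$, $reduce(\overline{c})=(c_1-\tfrac s2,\dots,c_{k-2}-\tfrac s2)$. Let $H_i=2^i-1$. Intervals: $I(k-1)=[-\tfrac12,\tfrac{H_{k-1}}2]$, $I(-k)=[-\tfrac{H_{k-1}}2,0]$, $I(\pm k)=[-\tfrac{H_{k-1}}2,\tfrac{H_{k-1}}2]$. Define $Cyc(x)=\max(x,-x-1)$, $Dec_i(x)=\min(x,-x+H_i)$, $Min(x)=\min(x,-x)$ (maps $\mathbb{R}\to\mathbb{R}$) and $MinMax(x,y)=(\min(x,y),\max(x,y))$ ($\mathbb{R}^2\to\mathbb{R}^2$). Let $\hat{Q}^k_1=(Cyc)\oplus\bigoplus_{i=1}^{\lfloor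 (k-3)/3\rfloor}(Dec_{k-3i},MinMax)\oplus F^k_1$ ($\oplus$ is concatenation), where $F^k_1=()$ if $k\equiv 0$, $F^k_1=(Dec_1)$ if $k\equiv 1$, $F^k_1=(Dec_2,Min)$ if $k\equiv 2 \pmod 3$. $\bigotimes\hat{Q}^k_1$ is the Cartesian product map on $\mathbb{R}^{k-2}$: split the coordinates into consecutive blocks whose sizes are the arities (1 or 2) of the functions in the sequence $\hat{Q}^k_1$, in order, and apply each function to its block. -}

module Defs where

open import Data.Nat as ℕ using (ℕ; zero; suc; _∸_; _^_)
open import Data.Nat.DivMod using (_/_; _%_)
open import Data.Integer as ℤ using (ℤ; +_)
open import Data.Rational as ℚ using (ℚ; _⊓_; _⊔_; ½; 0ℚ; 1ℚ)
open import Data.List using (List; []; _∷_; _++_; map; take; reverse; zipWith; concat; upTo; length)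
open import Data.List.Relation.Unary.All using (All)
open import Data.List.Relation.Unary.Linked using (Linked)
open import Data.List.Relation.Binary.Pointwise using (Pointwise)
open import Data.Product using (_×_; _,_)
open import Data.Unit using (⊤)

-- first and last entries (default 0 for the empty list; only used on
-- nonempty sequences)
headOr0 : List ℤ → ℤ
headOr0 []      = + 0
headOr0 (x ∷ _) = x

lastOr0 : List ℤ → ℤ
lastOr0 []           = + 0
lastOr0 (x ∷ [])     = x
lastOr0 (_ ∷ y ∷ ys) = lastOr0 (y ∷ ys)

Flat : List ℤ → Set
Flat []       = ⊤
Flat (x ∷ xs) = Linked ℤ._≤_ (x ∷ xs) × (lastOr0 (x ∷ xs) ℤ.≤ x ℤ.+ + 1)

oddPos evenPos : List ℤ → List ℤ
oddPos []           = []
oddPos (x ∷ [])     = x ∷ []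
oddPos (x ∷ _ ∷ xs) = x ∷ oddPos xs
evenPos []           = []
evenPos (_ ∷ [])     = []
evenPos (_ ∷ y ∷ xs) = y ∷ evenPos xs

TwoFlat : List ℤ → Set
TwoFlat c = Flat (oddPos c) × Flat (evenPos c)

height : List ℤ → ℤ
height c = headOr0 c ℤ.+ lastOr0 c

-- balanced (for a sequence of length 2m): c_i + c_{2m-i+1} = c₁ + c_{2m}
-- for i = 2, …, m.  The list  zipWith _+_ c (reverse c)  has i-th entry
-- c_i + c_{2m-i+1}; its entries with index 2..m are required to equal the
-- height.
Balanced : List ℤ → Set
Balanced c = All (λ v → v ≡h height c)
                 (drop1 (take (length c / 2) (zipWith ℤ._+_ c (reverse c))))
  where
  open import Relation.Binary.PropositionalEquality using (_≡_)
  _≡h_ : ℤ → ℤ → Set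
  _≡h_ = _≡_
  drop1 : List ℤ → List ℤ
  drop1 []       = []
  drop1 (_ ∷ xs) = xs

⟦_⟧ : ℤ → ℚ
⟦ z ⟧ = z ℚ./ 1

reduce : ℕ → List ℤ → List ℚ
reduce k c = map (λ ci → ⟦ ci ⟧ ℚ.- ⟦ height c ⟧ ℚ.* ½) (take (k ∸ 2) c)

H : ℕ → ℚ
H i = ⟦ + (2 ^ i) ⟧ ℚ.- 1ℚ

Cyc : ℚ → ℚ
Cyc x = x ⊔ (ℚ.- x ℚ.- 1ℚ)

Dec : ℕ → ℚ → ℚ
Dec i x = x ⊓ (ℚ.- x ℚ.+ H i)

Min : ℚ → ℚ
Min x = x ⊓ (ℚ.- x)

MinMax : ℚ → ℚ → ℚ × ℚ
MinMax x y = (x ⊓ y , x ⊔ y)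

data Fn : Set where
  un  : (ℚ → ℚ) → Fn
  bin : (ℚ → ℚ → ℚ × ℚ) → Fn

-- Cartesian product map ⨂ of a sequence of functions: split the
-- coordinates into consecutive blocks of the arities and apply.
-- (Leftover coordinates / missing coordinates cannot occur in use.)
⨂ : List Fn → List ℚ → List ℚ
⨂ []           xs           = xs
⨂ (un f ∷ fs)  (x ∷ xs)     = f x ∷ ⨂ fs xs
⨂ (bin f ∷ fs) (x ∷ y ∷ xs) with f x y
... | (a , b) = a ∷ b ∷ ⨂ fs xs
⨂ (_ ∷ _)      _            = []

F1 : ℕ → List Fn
F1 k with k % 3
... | 0 = []
... | 1 = un (Dec 1) ∷ []
... | _ = un (Dec 2) ∷ un Min ∷ []

-- Q̂^k_1 = (Cyc) ⊕ ⨁_{i=1}^{⌊(k-3)/3⌋} (Dec_{k-3i}, MinMax) ⊕ F^k_1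
Qhat1 : ℕ → List Fn
Qhat1 k = un Cyc ∷ concat (map (λ j → un (Dec (k ∸ 3 ℕ.* suc j)) ∷ bin MinMax ∷ [])
                               (upTo ((k ∸ 3) / 3)))
          ++ F1 k

record Interval : Set where
  constructor [_,_]
  field lo hi : ℚ

_∈I_ : ℚ → Interval → Set
x ∈I [ a , b ] = (a ℚ.≤ x) × (x ℚ.≤ b)

I-pos : ℕ → Interval
I-pos k = [ ℚ.- ½ , H (k ∸ 1) ℚ.* ½ ]

I-neg : ℕ → Interval
I-neg k = [ ℚ.- (H (k ∸ 1) ℚ.* ½) , 0ℚ ]

I-pm : ℕ → Interval
I-pm k = [ ℚ.- (H (k ∸ 1) ℚ.* ½) , H (k ∸ 1) ℚ.* ½ ]

J : ℕ → ℕ → Interval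
J k l with l % 3
... | 0 = I-neg k
... | _ = I-pm k

IX1 : ℕ → List Interval
IX1 k = I-pos k ∷ map (λ i → J k (i ℕ.+ 2)) (upTo (k ∸ 3))

_∈Box_ : List ℚ → List Interval → Set
xs ∈Box Is = Pointwise _∈I_ xs Is

-- Balancedness pairs c_i with its mirror c_{2m+1-i}, and the two sum to the height s; hence
-- d_i = c_i - s/2 = (c_i - c_{2m+1-i})/2 lies in [-G, G] with G = H_{k-1}/2.  Two-flatness gives
-- c_{i+1} <= c_{2m+1-i} (same parity, earlier position), so d_i + d_{i+1} <= 0: consecutive
-- coordinates of reduce(c) are never both positive.  Both facts follow by peeling the outer pair
-- (c_1, c_{2m}) off the sequence.  Each map of Q̂ then sends such coordinates into its interval:
-- Cyc into [-1/2, G], Dec_i preserves [-G, G], Min lands in [-G, 0], and MinMax of a pair that is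
-- not both positive lands in [-G, 0] × [-G, G]; the blocks (Dec, MinMax) repeat with period 3,
-- exactly as the intervals J_l do.
module Submission where

open import Defs
open import Data.Nat as ℕ using (ℕ; zero; suc; _∸_; s≤s; z≤n)
import Data.Nat.Properties as ℕ
open import Data.Nat.DivMod using (_/_; _%_; m%n<n; m≡m%n+[m/n]*n; m*n/n≡m)
open import Data.Integer as ℤ using (ℤ; +_; -[1+_])
import Data.Integer.Properties as ℤ
open import Data.List using (List; []; _∷_; _++_; _∷ʳ_; map; take; drop; reverse; zipWith;
  concat; upTo; applyUpTo; length; initLast; _∷ʳ′_)
open import Data.List.Properties
  using (length-++; length-map; length-take; length-upTo; length-reverse; map-upTo; unfold-reverse; reverse-++)
open import Data.List.Relation.Unary.All using (All; []; _∷_)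
import Data.List.Relation.Unary.All.Properties as All
open import Data.List.Relation.Unary.Linked as Linked using (Linked; []; [-]; _∷_)
open import Data.List.Relation.Binary.Pointwise using ([]; _∷_)
open import Data.Product using (_×_; _,_)
open import Data.Sum using (_⊎_; inj₁; inj₂)
open import Function using (_∘_)
open import Relation.Binary.Definitions using (Transitive)
open import Relation.Binary.PropositionalEquality
  using (_≡_; refl; sym; trans; cong; cong₂; subst; subst₂; module ≡-Reasoning)

take-++ˡ : ∀ {A : Set} n (xs ys : List A) → n ℕ.≤ length xs → take n (xs ++ ys) ≡ take n xs
take-++ˡ zero    xs       ys _        = refl
take-++ˡ (suc n) (x ∷ xs) ys (s≤s n≤) = cong (x ∷_) (take-++ˡ n xs ys n≤)

take-zipWith-∷ʳ : ∀ {A B C : Set} (f : A → B → C) n xs ys {u v} →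
                  n ℕ.≤ length xs → n ℕ.≤ length ys →
                  take n (zipWith f (xs ∷ʳ u) (ys ∷ʳ v)) ≡ take n (zipWith f xs ys)
take-zipWith-∷ʳ f zero    xs       ys       _          _          = refl
take-zipWith-∷ʳ f (suc n) (x ∷ xs) (y ∷ ys) (s≤s n≤xs) (s≤s n≤ys) =
  cong (f x y ∷_) (take-zipWith-∷ʳ f n xs ys n≤xs n≤ys)

Linked-∷ʳ⁻ : ∀ {A : Set} {R : A → A → Set} → Transitive R → ∀ xs {y} →
             Linked R (xs ∷ʳ y) → Linked R xs × All (λ x → R x y) xs
Linked-∷ʳ⁻ R-trans []            _             = [] , []
Linked-∷ʳ⁻ R-trans (x ∷ [])      (Rxy ∷ _)     = [-] , Rxy ∷ []
Linked-∷ʳ⁻ R-trans (x ∷ x′ ∷ xs) (Rxx′ ∷ rest) with Linked-∷ʳ⁻ R-trans (x′ ∷ xs) rest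
... | linked , Rx′y ∷ Rxsy = Rxx′ ∷ linked , R-trans Rxx′ Rx′y ∷ Rx′y ∷ Rxsy

-- Even lengths are written n * 2 rather than 2 * n, since suc n * 2 reduces to suc (suc (n * 2)).
n≤length : ∀ {A : Set} {n} (l : List A) → length l ≡ n ℕ.* 2 → n ℕ.≤ length l
n≤length {n = n} l len = subst (n ℕ.≤_) (sym len) (ℕ.m≤m*n n 2)

data Peeled {A : Set} (n : ℕ) : List A → Set where
  peeled : ∀ x l y → length l ≡ n ℕ.* 2 → Peeled n (x ∷ l ∷ʳ y)

peel : ∀ {A : Set} n (c : List A) → length c ≡ suc n ℕ.* 2 → Peeled n c
peel n (x ∷ rest) len with initLast rest
peel n (x ∷ .[])        ()  | []
peel n (x ∷ .(l ∷ʳ y)) len | l ∷ʳ′ y =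
  peeled x l y (ℕ.suc-injective (trans (sym length-∷ʳ) (ℕ.suc-injective len)))
  where
  length-∷ʳ : length (l ∷ʳ y) ≡ suc (length l)
  length-∷ʳ = trans (length-++ l) (ℕ.+-comm (length l) 1)

module _ where
  open import Data.Rational using (ℚ; mkℚ; _≤_; _+_; _-_; -_; _*_; _⊓_; _⊔_; ½; 0ℚ; 1ℚ; *≤*)
  open import Data.Rational.Properties
  open import Data.Rational.Solver using (module +-*-Solver)
  open import Data.Nat.Coprimality using (1-coprimeTo)
  import Data.Nat.Coprimality as Coprime
  open import Algebra.Properties.Group +-0-group using (⁻¹-involutive)
  open +-*-Solver using (solve; _:=_; _:+_; _:*_; _:-_; con)

  ⟦⟧≡mkℚ : ∀ z → ⟦ z ⟧ ≡ mkℚ z 0 (Coprime.sym (1-coprimeTo _))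
  ⟦⟧≡mkℚ (+ n)    = normalize-coprime {n} {0} (Coprime.sym (1-coprimeTo _))
  ⟦⟧≡mkℚ -[1+ n ] = cong -_ (normalize-coprime {suc n} {0} (Coprime.sym (1-coprimeTo _)))

  ⟦⟧-+ : ∀ a b → ⟦ a ℤ.+ b ⟧ ≡ ⟦ a ⟧ + ⟦ b ⟧
  ⟦⟧-+ a b rewrite ⟦⟧≡mkℚ a | ⟦⟧≡mkℚ b =
    cong ⟦_⟧ (sym (cong₂ ℤ._+_ (ℤ.*-identityʳ a) (ℤ.*-identityʳ b)))

  ⟦⟧-mono-≤ : ∀ {a b} → a ℤ.≤ b → ⟦ a ⟧ ≤ ⟦ b ⟧
  ⟦⟧-mono-≤ {a} {b} a≤b rewrite ⟦⟧≡mkℚ a | ⟦⟧≡mkℚ b =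
    *≤* (subst₂ ℤ._≤_ (sym (ℤ.*-identityʳ a)) (sym (ℤ.*-identityʳ b)) a≤b)

  ⟦2^i-1⟧≡H : ∀ i → ⟦ + (2 ℕ.^ i) ℤ.- + 1 ⟧ ≡ H i
  ⟦2^i-1⟧≡H i = ⟦⟧-+ (+ (2 ℕ.^ i)) -[1+ 0 ]

  H-nonNeg : ∀ i → 0ℚ ≤ H i
  H-nonNeg i = ≤-trans (≤-reflexive (sym (+-inverseʳ 1ℚ)))
                       (+-monoˡ-≤ (- 1ℚ) (⟦⟧-mono-≤ (ℤ.+≤+ (ℕ.m^n>0 2 i))))

  p≤p+q : ∀ p {q} → 0ℚ ≤ q → p ≤ p + q
  p≤p+q p {q} 0≤q = ≤-trans (≤-reflexive (sym (+-identityʳ p))) (+-monoʳ-≤ p 0≤q)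

  p≤q+p : ∀ p {q} → 0ℚ ≤ q → p ≤ q + p
  p≤q+p p {q} 0≤q = ≤-trans (≤-reflexive (sym (+-identityˡ p))) (+-monoˡ-≤ p 0≤q)

  p+q≤p : ∀ p {q} → q ≤ 0ℚ → p + q ≤ p
  p+q≤p p {q} q≤0 = ≤-trans (+-monoʳ-≤ p q≤0) (≤-reflexive (+-identityʳ p))

  neg-≤-swap : ∀ {G x} → - G ≤ x → - x ≤ G
  neg-≤-swap {G} {x} -G≤x = subst (- x ≤_) (⁻¹-involutive G) (neg-antimono-≤ -G≤x)

  half-difference-∈I : ∀ {T X Y} → 0ℚ ≤ X → X ≤ T → 0ℚ ≤ Y → Y ≤ T →
                       ((X - Y) * ½) ∈I [ - (T * ½) , T * ½ ]
  half-difference-∈I {T} {X} {Y} 0≤X X≤T 0≤Y Y≤T =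
    subst (_≤ (X - Y) * ½) (sym (neg-distribˡ-* T ½)) (*-monoʳ-≤-nonNeg ½ -T≤X-Y) ,
    *-monoʳ-≤-nonNeg ½ X-Y≤T
    where
    -T≤X-Y : - T ≤ X - Y
    -T≤X-Y = ≤-trans (p≤q+p (- T) 0≤X) (+-monoʳ-≤ X (neg-antimono-≤ Y≤T))
    X-Y≤T : X - Y ≤ T
    X-Y≤T = ≤-trans (+-monoʳ-≤ X (neg-antimono-≤ 0≤Y)) (≤-trans (p+q≤p X ≤-refl) X≤T)

  NotBothPositive : ℚ → ℚ → Set
  NotBothPositive x y = x ≤ 0ℚ ⊎ y ≤ 0ℚ

  sum-nonPos⇒NotBothPositive : ∀ {x y} → x + y ≤ 0ℚ → NotBothPositive x y
  sum-nonPos⇒NotBothPositive {x} {y} x+y≤0 with ≤-total x 0ℚ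
  ... | inj₁ x≤0 = inj₁ x≤0
  ... | inj₂ 0≤x = inj₂ (≤-trans (p≤q+p y 0≤x) x+y≤0)

  Cyc-∈I : ∀ {G x} → x ∈I [ - G , G ] → Cyc x ∈I [ - ½ , G ]
  Cyc-∈I {G} {x} (-G≤x , x≤G) =
    -½≤Cyc , ⊔-lub x≤G (≤-trans (p+q≤p (- x) (*≤* ℤ.-≤+)) (neg-≤-swap -G≤x))
    where
    -½≤Cyc : - ½ ≤ Cyc x
    -½≤Cyc with ≤-total (- ½) x
    ... | inj₁ -½≤x = ≤-trans -½≤x (p≤p⊔q x _)
    ... | inj₂ x≤-½ = ≤-trans (+-monoˡ-≤ (- 1ℚ) (neg-antimono-≤ x≤-½)) (p≤q⊔p x _)

  Dec-∈I : ∀ {G x} i → x ∈I [ - G , G ] → Dec i x ∈I [ - G , G ]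
  Dec-∈I {G} {x} i (-G≤x , x≤G) =
    ⊓-glb -G≤x (≤-trans (neg-antimono-≤ x≤G) (p≤p+q (- x) (H-nonNeg i))) , p≤q⇒p⊓r≤q _ x≤G

  Min-∈I : ∀ {G x} → x ∈I [ - G , G ] → Min x ∈I [ - G , 0ℚ ]
  Min-∈I {G} {x} (-G≤x , x≤G) = ⊓-glb -G≤x (neg-antimono-≤ x≤G) , Min≤0
    where
    Min≤0 : Min x ≤ 0ℚ
    Min≤0 with ≤-total x 0ℚ
    ... | inj₁ x≤0 = p≤q⇒p⊓r≤q _ x≤0
    ... | inj₂ 0≤x = p≤q⇒r⊓p≤q x (neg-antimono-≤ 0≤x)

  MinMax-∈I : ∀ {G x y} → x ∈I [ - G , G ] → y ∈I [ - G , G ] → NotBothPositive x y →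
              ((x ⊓ y) ∈I [ - G , 0ℚ ]) × ((x ⊔ y) ∈I [ - G , G ])
  MinMax-∈I {x = x} (-G≤x , x≤G) (-G≤y , y≤G) x≤0⊎y≤0 =
    (⊓-glb -G≤x -G≤y , min≤0 x≤0⊎y≤0) , (≤-trans -G≤x (p≤p⊔q x _) , ⊔-lub x≤G y≤G)
    where
    min≤0 : NotBothPositive x _ → x ⊓ _ ≤ 0ℚ
    min≤0 (inj₁ x≤0) = p≤q⇒p⊓r≤q _ x≤0
    min≤0 (inj₂ y≤0) = p≤q⇒r⊓p≤q x y≤0

  data MapsInto (G : ℚ) : List Fn → List Interval → Set where
    []      : MapsInto G [] []
    Dec∷    : ∀ {fs Is} i → MapsInto G fs Is → MapsInto G (un (Dec i) ∷ fs) ([ - G , G ] ∷ Is)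
    Min∷    : ∀ {fs Is} → MapsInto G fs Is → MapsInto G (un Min ∷ fs) ([ - G , 0ℚ ] ∷ Is)
    MinMax∷ : ∀ {fs Is} → MapsInto G fs Is →
              MapsInto G (bin MinMax ∷ fs) ([ - G , 0ℚ ] ∷ [ - G , G ] ∷ Is)

  ⨂-∈Box : ∀ {G fs Is ds} → MapsInto G fs Is → All (_∈I [ - G , G ]) ds →
           Linked NotBothPositive ds → length ds ≡ length Is → ⨂ fs ds ∈Box Is
  ⨂-∈Box {ds = []}    []          []         _   _   = []
  ⨂-∈Box {ds = _ ∷ _} (Dec∷ i fs) (x∈ ∷ xs∈) alt len =
    Dec-∈I i x∈ ∷ ⨂-∈Box fs xs∈ (Linked.tail alt) (ℕ.suc-injective len)
  ⨂-∈Box {ds = _ ∷ _} (Min∷ fs)   (x∈ ∷ xs∈) alt len =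
    Min-∈I x∈ ∷ ⨂-∈Box fs xs∈ (Linked.tail alt) (ℕ.suc-injective len)
  ⨂-∈Box {ds = _ ∷ _ ∷ _} (MinMax∷ fs) (x∈ ∷ y∈ ∷ xs∈) (x⊎y ∷ alt) len
    with min∈ , max∈ ← MinMax-∈I x∈ y∈ x⊎y =
    min∈ ∷ max∈ ∷ ⨂-∈Box fs xs∈ (Linked.tail alt) (ℕ.suc-injective (ℕ.suc-injective len))

  centre : ℤ → ℤ → ℚ
  centre s a = ⟦ a ⟧ - ⟦ s ⟧ * ½

  centre-∈I : ∀ {s T a b} → a ℤ.+ b ≡ s → + 0 ℤ.≤ a → a ℤ.≤ T → + 0 ℤ.≤ b → b ℤ.≤ T →
              centre s a ∈I [ - (⟦ T ⟧ * ½) , ⟦ T ⟧ * ½ ]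
  centre-∈I {T = T} {a} {b} refl 0≤a a≤T 0≤b b≤T =
    subst (_∈I [ - (⟦ T ⟧ * ½) , ⟦ T ⟧ * ½ ]) (sym centre≡)
          (half-difference-∈I (⟦⟧-mono-≤ 0≤a) (⟦⟧-mono-≤ a≤T) (⟦⟧-mono-≤ 0≤b) (⟦⟧-mono-≤ b≤T))
    where
    centre≡ : centre (a ℤ.+ b) a ≡ (⟦ a ⟧ - ⟦ b ⟧) * ½
    centre≡ = trans (cong (λ S → ⟦ a ⟧ - S * ½) (⟦⟧-+ a b))
                    (solve 2 (λ A B → A :- (A :+ B) :* con ½ := (A :- B) :* con ½) refl ⟦ a ⟧ ⟦ b ⟧)

  centre-NotBothPositive : ∀ {s a b} → a ℤ.+ b ℤ.≤ s → NotBothPositive (centre s a) (centre s b)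
  centre-NotBothPositive {s} {a} {b} a+b≤s =
    sum-nonPos⇒NotBothPositive (subst (_≤ 0ℚ) (sym sum≡) diff≤0)
    where
    sum≡ : centre s a + centre s b ≡ ⟦ a ℤ.+ b ⟧ - ⟦ s ⟧
    sum≡ = trans (solve 3 (λ A B S → (A :- S :* con ½) :+ (B :- S :* con ½) := (A :+ B) :- S)
                          refl ⟦ a ⟧ ⟦ b ⟧ ⟦ s ⟧)
                 (cong (_- ⟦ s ⟧) (sym (⟦⟧-+ a b)))
    diff≤0 : ⟦ a ℤ.+ b ⟧ - ⟦ s ⟧ ≤ 0ℚ
    diff≤0 = ≤-trans (+-monoˡ-≤ (- ⟦ s ⟧) (⟦⟧-mono-≤ a+b≤s)) (≤-reflexive (+-inverseʳ ⟦ s ⟧))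

-- J k (3 + l) and J k l reduce to the same term, since (3 + l) % 3 computes to l % 3.
module _ (k : ℕ) where
  open import Data.Rational using (½; -_; _*_)

  blocks-MapsInto : ∀ (g : ℕ → ℕ) q r {fs} →
    MapsInto (H (k ∸ 1) * ½) fs (applyUpTo (λ i → J k (i ℕ.+ 2)) r) →
    MapsInto (H (k ∸ 1) * ½) (concat (applyUpTo (λ j → un (Dec (g j)) ∷ bin MinMax ∷ []) q) ++ fs)
                             (applyUpTo (λ i → J k (i ℕ.+ 2)) (q ℕ.* 3 ℕ.+ r))
  blocks-MapsInto g zero    r fs↦ = fs↦
  blocks-MapsInto g (suc q) r fs↦ = Dec∷ (g 0) (MinMax∷ (blocks-MapsInto (g ∘ suc) q r fs↦))

  F1-MapsInto : MapsInto (H (k ∸ 1) * ½) (F1 k) (applyUpTo (λ i → J k (i ℕ.+ 2)) (k % 3))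
  F1-MapsInto with k % 3 | m%n<n k 3
  ... | 0 | _ = []
  ... | 1 | _ = Dec∷ 1 []
  ... | 2 | _ = Dec∷ 2 (Min∷ [])
  ... | suc (suc (suc _)) | s≤s (s≤s (s≤s ()))

module _ where
  open import Data.Rational using (½; -_; _*_)

  Qhat1-∈Box : ∀ m {ds} → All (_∈I [ - (H (2 ℕ.+ m) * ½) , H (2 ℕ.+ m) * ½ ]) ds →
               Linked NotBothPositive ds → length ds ≡ suc m →
               ⨂ (Qhat1 (3 ℕ.+ m)) ds ∈Box IX1 (3 ℕ.+ m)
  Qhat1-∈Box m {_ ∷ ds} (d∈ ∷ ds∈) alt len =
    Cyc-∈I d∈ ∷ ⨂-∈Box tail↦ ds∈ (Linked.tail alt)
                  (trans (ℕ.suc-injective len) (sym (trans (length-map _ (upTo m)) (length-upTo m))))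
    where
    k = 3 ℕ.+ m
    m≡q*3+r : m ≡ m / 3 ℕ.* 3 ℕ.+ m % 3
    m≡q*3+r = trans (m≡m%n+[m/n]*n m 3) (ℕ.+-comm (m % 3) _)
    tail↦ : MapsInto (H (k ∸ 1) * ½)
      (concat (map (λ j → un (Dec (k ∸ 3 ℕ.* suc j)) ∷ bin MinMax ∷ []) (upTo (m / 3))) ++ F1 k)
      (map (λ i → J k (i ℕ.+ 2)) (upTo m))
    tail↦ = subst₂ (MapsInto _)
      (cong (λ bs → concat bs ++ F1 k) (sym (map-upTo _ (m / 3))))
      (trans (cong (applyUpTo _) (sym m≡q*3+r)) (sym (map-upTo _ m)))
      (blocks-MapsInto k (λ j → k ∸ 3 ℕ.* suc j) (m / 3) (m % 3) (F1-MapsInto k))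

lastOr0-∷ʳ : ∀ xs y → lastOr0 (xs ∷ʳ y) ≡ y
lastOr0-∷ʳ []           y = refl
lastOr0-∷ʳ (_ ∷ [])     y = refl
lastOr0-∷ʳ (_ ∷ x ∷ xs) y = lastOr0-∷ʳ (x ∷ xs) y

oddPos-∷-∷ʳ : ∀ n x l y → length l ≡ n ℕ.* 2 → oddPos (x ∷ l ∷ʳ y) ≡ x ∷ evenPos l
oddPos-∷-∷ʳ zero    x []          y _   = refl
oddPos-∷-∷ʳ (suc n) x (a ∷ b ∷ l) y len =
  cong (x ∷_) (oddPos-∷-∷ʳ n b l y (ℕ.suc-injective (ℕ.suc-injective len)))

evenPos-∷-∷ʳ : ∀ n x l y → length l ≡ n ℕ.* 2 → evenPos (x ∷ l ∷ʳ y) ≡ oddPos l ∷ʳ y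
evenPos-∷-∷ʳ zero    x []          y _   = refl
evenPos-∷-∷ʳ (suc n) x (a ∷ b ∷ l) y len =
  cong (a ∷_) (evenPos-∷-∷ʳ n b l y (ℕ.suc-injective (ℕ.suc-injective len)))

ParitySorted : List ℤ → Set
ParitySorted c = Linked ℤ._≤_ (oddPos c) × Linked ℤ._≤_ (evenPos c)

TwoFlat⇒ParitySorted : ∀ c → TwoFlat c → ParitySorted c
TwoFlat⇒ParitySorted c (odd , even) = Flat⇒Linked (oddPos c) odd , Flat⇒Linked (evenPos c) even
  where
  Flat⇒Linked : ∀ l → Flat l → Linked ℤ._≤_ l
  Flat⇒Linked []      _            = []
  Flat⇒Linked (_ ∷ _) (sorted , _) = sorted

ParitySorted-peel : ∀ n x l y → length l ≡ n ℕ.* 2 → ParitySorted (x ∷ l ∷ʳ y) →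
                    ParitySorted l × All (ℤ._≤ y) (oddPos l)
ParitySorted-peel n x l y len (odd , even)
  with oddPos-sorted , oddPos≤y ←
       Linked-∷ʳ⁻ ℤ.≤-trans (oddPos l) (subst (Linked ℤ._≤_) (evenPos-∷-∷ʳ n x l y len) even)
  = (oddPos-sorted , Linked.tail (subst (Linked ℤ._≤_) (oddPos-∷-∷ʳ n x l y len) odd)) , oddPos≤y

mirrorSums : List ℤ → List ℤ
mirrorSums c = zipWith ℤ._+_ c (reverse c)

mirrorSums-∷-∷ʳ : ∀ x l y →
                  mirrorSums (x ∷ l ∷ʳ y) ≡ x ℤ.+ y ∷ zipWith ℤ._+_ (l ∷ʳ y) (reverse l ∷ʳ x)
mirrorSums-∷-∷ʳ x l y = cong (zipWith ℤ._+_ (x ∷ l ∷ʳ y)) (begin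
  reverse (x ∷ l ∷ʳ y)   ≡⟨ unfold-reverse x (l ∷ʳ y) ⟩
  reverse (l ∷ʳ y) ∷ʳ x  ≡⟨ cong (_∷ʳ x) (reverse-++ l (y ∷ [])) ⟩
  y ∷ reverse l ∷ʳ x     ∎)
  where open ≡-Reasoning

MirrorSums : ℤ → ℕ → List ℤ → Set
MirrorSums s n c = All (_≡ s) (take n (mirrorSums c))

MirrorSums-peel : ∀ {s} n x l y → length l ≡ n ℕ.* 2 → MirrorSums s (suc n) (x ∷ l ∷ʳ y) →
                  x ℤ.+ y ≡ s × MirrorSums s n l
MirrorSums-peel {s} n x l y len sums
  with x+y≡s ∷ inner ← subst (All (_≡ s) ∘ take (suc n)) (mirrorSums-∷-∷ʳ x l y) sums
  = x+y≡s , subst (All (_≡ s)) (take-zipWith-∷ʳ ℤ._+_ n l (reverse l) n≤length-l n≤length-reverse) inner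
  where
  n≤length-l : n ℕ.≤ length l
  n≤length-l = n≤length l len
  n≤length-reverse : n ℕ.≤ length (reverse l)
  n≤length-reverse = subst (n ℕ.≤_) (sym (length-reverse l)) n≤length-l

-- Defs phrases Balanced with a private drop1; abstracting the list lets it meet drop 1.
Balanced⇒drop1 : ∀ c → Balanced c → All (_≡ height c) (drop 1 (take (length c / 2) (mirrorSums c)))
Balanced⇒drop1 c bal with take (length c / 2) (mirrorSums c)
... | []    = []
... | _ ∷ _ = bal

Balanced⇒MirrorSums : ∀ n c → length c ≡ n ℕ.* 2 → Balanced c → MirrorSums (height c) n c
Balanced⇒MirrorSums zero    c _   _   = []
Balanced⇒MirrorSums (suc n) c len bal with peel n c len
... | peeled x l y _ =
  subst (All (_≡ height c) ∘ take (suc n)) (sym (mirrorSums-∷-∷ʳ x l y))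
        (cong (λ z → x ℤ.+ z) (sym (lastOr0-∷ʳ (x ∷ l) y))
         ∷ subst (All (_≡ height c) ∘ drop 1 ∘ take (suc n)) (mirrorSums-∷-∷ʳ x l y) tail-sums)
  where
  tail-sums : All (_≡ height c) (drop 1 (take (suc n) (mirrorSums c)))
  tail-sums = subst (λ h → All (_≡ height c) (drop 1 (take h (mirrorSums c))))
                    (trans (cong (_/ 2) len) (m*n/n≡m (suc n) 2)) (Balanced⇒drop1 c bal)

InRange : ℤ → ℤ → Set
InRange T a = (+ 0 ℤ.≤ a) × (a ℤ.≤ T)

module _ {s : ℤ} where
  open import Data.Rational using (½; -_; _*_)

  centred-∈I : ∀ {T} n c → length c ≡ n ℕ.* 2 → MirrorSums s n c → All (InRange T) c →
               All (_∈I [ - (⟦ T ⟧ * ½) , ⟦ T ⟧ * ½ ]) (map (centre s) (take n c))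
  centred-∈I zero    c _   _    _      = []
  centred-∈I (suc n) c len sums ranges with peel n c len
  ... | peeled x l y len′
    with x+y≡s , sums′ ← MirrorSums-peel n x l y len′ sums
       | (0≤x , x≤T) ∷ ranges′ ← ranges
    with ranges-l , (0≤y , y≤T) ∷ [] ← All.++⁻ l ranges′
    rewrite take-++ˡ n l (y ∷ []) (n≤length l len′)
    = centre-∈I x+y≡s 0≤x x≤T 0≤y y≤T ∷ centred-∈I n l len′ sums′ ranges-l

  centre-∷-NotBothPositive : ∀ {x y} n l → length l ≡ n ℕ.* 2 → x ℤ.+ y ≡ s →
    All (ℤ._≤ y) (oddPos l) → Linked NotBothPositive (map (centre s) (take n l)) →
    Linked NotBothPositive (map (centre s) (x ∷ take n l))
  centre-∷-NotBothPositive zero    _           _ _     _         _   = [-]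
  centre-∷-NotBothPositive {x} (suc n) (a ∷ b ∷ l) _ x+y≡s (a≤y ∷ _) alt =
    centre-NotBothPositive {s} {x} {a} (ℤ.≤-trans (ℤ.+-monoʳ-≤ x a≤y) (ℤ.≤-reflexive x+y≡s)) ∷ alt

  centred-NotBothPositive : ∀ n c → length c ≡ n ℕ.* 2 → MirrorSums s n c → ParitySorted c →
                            Linked NotBothPositive (map (centre s) (take n c))
  centred-NotBothPositive zero    c _   _    _      = []
  centred-NotBothPositive (suc n) c len sums sorted with peel n c len
  ... | peeled x l y len′
    with x+y≡s , sums′ ← MirrorSums-peel n x l y len′ sums
       | sorted′ , oddPos≤y ← ParitySorted-peel n x l y len′ sorted
    rewrite take-++ˡ n l (y ∷ []) (n≤length l len′)
    = centre-∷-NotBothPositive {x} {y} n l len′ x+y≡s oddPos≤y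
        (centred-NotBothPositive n l len′ sums′ sorted′)

-- Opened only here: unqualified, these names would clash with the rational ones above.
open import Data.Nat using (ℕ; _≤_; _*_; _∸_; _^_)

lemma6 : (k : ℕ) → 3 ≤ k → (c : List ℤ) → length c ≡ 2 * (k ∸ 2) →
    All (λ x → (+ 0 ℤ.≤ x) × (x ℤ.≤ + (2 ^ (k ∸ 1)) ℤ.- + 1)) c →
    Balanced c → TwoFlat c →
    (⨂ (Qhat1 k) (reduce k c)) ∈Box (IX1 k)
lemma6 (suc (suc (suc m))) (s≤s (s≤s (s≤s z≤n))) c len ranges bal twoFlat =
  Qhat1-∈Box m (subst (λ t → All (_∈I [ - (t *ℚ ½) , t *ℚ ½ ]) (reduce k c)) (⟦2^i-1⟧≡H (k ∸ 1))
                      (centred-∈I n c len′ sums ranges))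
               (centred-NotBothPositive n c len′ sums (TwoFlat⇒ParitySorted c twoFlat))
               length-reduce
  where
  open import Data.Rational using (½; -_) renaming (_*_ to _*ℚ_)
  k = 3 ℕ.+ m
  n = k ∸ 2
  len′ : length c ≡ n * 2
  len′ = trans len (ℕ.*-comm 2 n)
  sums : MirrorSums (height c) n c
  sums = Balanced⇒MirrorSums n c len′ bal
  length-reduce : length (reduce k c) ≡ n
  length-reduce = trans (length-map _ (take n c))
                        (trans (length-take n c) (ℕ.m≤n⇒m⊓n≡m (n≤length c len′)))
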